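{- Let $b:\omega\to\omega\smallsetminus\{0\}$, let $\mathbb{T}$ be a $b$-tree forcing notion, and let $D\subseteq\omega^\omega$ be a dominating family of increasing functions. Suppose that for each $f\in D$, $\sigma^f\in(\mathrm{sq}_{<\omega}(b))^\omega$ satisfies $\mathrm{ht}_{\sigma^f}=f^*$. Then for every $T\in\mathbb{T}$ there are $S\in\mathbb{T}$ with $S\le T$ and $f\in D$ such that $[\sigma^f]_\infty\cap[S]=\emptyset$. In particular, $\mathbb{T}$ forces $\tau\notin\bigcap_{f\in D}[\sigma^f]_\infty$, where $\tau\in\prod b$ is the generic real added by $\mathbb{T}$.
   Context: $\mathrm{sq}_{<\omega}(b):=\bigcup_{n<\omega}\prod_{i<n}b(i)$, $\prod b:=\prod_{i<\omega}b(i)$. For $\sigma\in(\mathrm{sq}_{<\omega}(b))^\omega$, $\mathrm{ht}_\sigma\in\omega^\omega$ is $\mathrm{ht}_\sigma(i):=|\sigma(i)|$, and $[\sigma]_\infty:=\{x\in\prod b:\exists^\infty n\,(\sigma(n)\subseteq x)\}$. $D$ dominating means every $g\in\omega^\omega$ satisfies $g\le^* f$ (i.e. $g(n)\le f(n)$ for all but finitely many $n$) for some $f\in D$. For increasing $f\in\omega^\omega$, $f^*:\omega\to\omega$ is defined by $f^*(0)=0$, $f^*(n+1)=f(f^*(n)+1)$. The generic real $\tau$ is the element of $\prod b$ all of whose initial segments belong to every condition in the generic filter. Tree notation: a tree is a set $T\subseteq\omega^{<\omega}$ containing the empty sequence and closed under initial segments. $\mathrm{Lv}_n(T):=T\cap\omega^n$;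 for $s\in T$, $T^s:=\{t\in T:s\subseteq t\text{ or }t\subseteq s\}$; $[T]$ is the set of $x\in\omega^\omega$ with $x{\upharpoonright}n\in T$ for all $n$. A node $s\in T$ is splitting if $s^\frown\langle i\rangle,s^\frown\langle j\rangle\in T$ for some $i\ne j$; $\mathrm{spl}_n(T)$ is the set of splitting nodes with exactly $n$ splitting nodes strictly below them. For trees $T'\subseteq T$, $T'\subseteq_n T$ means there is $m$ such that all elements of $\mathrm{spl}_n(T)$ have length $<m$ and $T'\cap\omega^m=T\cap\omega^m$. A poset $\mathbb{T}$ is a $b$-tree forcing notion if: (T1) $\mathbb{T}$ is a non-empty set of trees contained in $\mathrm{sq}_{<\omega}(b)$; (T2) if $T\in\mathbb{T}$, $s\in T$ then some splitting node of $T$ extends $s$; (T3) $T'\le T$ implies $T'\subseteq T$; (T4) if $T\in\mathbb{T}$, $s\in T$ then $T^s\in\mathbb{T}$ and $T^s\le T$; (T5) if $T\in\mathbb{T}$, $n<\omega$, and $S_t\in\mathbb{T}$ with $S_t\le T^t$ for each $t\in\mathrm{Lv}_n(T)$, then $S:=\bigcup_{t}S_t\in\mathbb{T}$, $S\le T$, and $\{S_t\}$ is a maximal antichain below $S$; (T6) if $\langle T_n\rangle$ is decreasing in $\mathbb{T}$ with $T_{n+1}\subseteq_nT_n$ for all $n$, then $\bigcap_nT_n\in\mathbb{T}$ and $\bigcap_nT_n\le T_n$ for all $n$. -}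

module Defs where

open import Level using (0ℓ)
open import Data.Nat using (ℕ; zero; suc; _<_; _≤_; _≥_)
open import Data.Fin using (Fin)
open import Data.List using (List; []; _∷_; _++_; length; map; upTo; take; _∷ʳ_)
open import Data.Product using (Σ; ∃; ∃-syntax; _×_; _,_)
open import Data.Empty using (⊥)
import Data.Sum
import Data.Fin
open import Relation.Nullary using (¬_)
open import Relation.Binary.PropositionalEquality using (_≡_; _≢_)

Seq : Set
Seq = List ℕ

Real : Set
Real = ℕ → ℕ

_⊑_ : Seq → Seq → Set
s ⊑ t = ∃[ u ] (s ++ u ≡ t)

_↾_ : Real → ℕ → Seq
x ↾ n = map x (upTo n)

_⊏_ : Seq → Real → Set
s ⊏ x = x ↾ length s ≡ s

data InSq (b : ℕ → ℕ) : ℕ → Seq → Set where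
  nil  : ∀ {i} → InSq b i []
  cons : ∀ {i k s} → k < b i → InSq b (suc i) s → InSq b i (k ∷ s)

Sq : (ℕ → ℕ) → Seq → Set
Sq b s = InSq b 0 s

InProd : (ℕ → ℕ) → Real → Set
InProd b x = ∀ i → x i < b i

-- subsets of ω^{<ω}
Tree : Set₁
Tree = Seq → Set

_⊆ᵀ_ : Tree → Tree → Set
T' ⊆ᵀ T = ∀ s → T' s → T s

IsTree : Tree → Set
IsTree T = T [] × (∀ s t → s ⊑ t → T t → T s)

Lv : ℕ → Tree → Tree
Lv n T s = T s × length s ≡ n

_^ᵀ_ : Tree → Seq → Tree
(T ^ᵀ s) t = T t × (Data.Sum._⊎_ (s ⊑ t) (t ⊑ s))

Body : Tree → Real → Set
Body T x = ∀ n → T (x ↾ n)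

Splitting : Tree → Seq → Set
Splitting T s = T s × ∃[ i ] ∃[ j ] (i ≢ j × T (s ∷ʳ i) × T (s ∷ʳ j))

-- s ∈ spl_n(T): s splitting and exactly n splitting nodes strictly below s,
-- witnessed by a strictly increasing enumeration e of the lengths of those nodes.
Spl : ℕ → Tree → Seq → Set
Spl n T s = Splitting T s ×
  Σ (Fin n → ℕ) λ e → ( (∀ (i j : Fin n) → Data.Fin._<_ i j → e i < e j)
         × (∀ i → e i < length s × Splitting T (take (e i) s))
         × (∀ k → k < length s → Splitting T (take k s) → ∃[ i ] (e i ≡ k)) )

_⊆[_]_ : Tree → ℕ → Tree → Set
T' ⊆[ n ] T = T' ⊆ᵀ T ×
  ∃[ m ] ((∀ s → Spl n T s → length s < m) ×
          (∀ s → length s ≡ m → (T' s → T s) × (T s → T' s)))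

record BTreeForcing (b : ℕ → ℕ) : Set₁ where
  field
    𝕋    : Tree → Set
    _≤ₜ_ : Tree → Tree → Set
    ≤-refl  : ∀ T → 𝕋 T → T ≤ₜ T
    ≤-trans : ∀ R S T → 𝕋 R → 𝕋 S → 𝕋 T → R ≤ₜ S → S ≤ₜ T → R ≤ₜ T
    nonempty : ∃[ T ] 𝕋 T
    T1-tree  : ∀ T → 𝕋 T → IsTree T
    T1-sq    : ∀ T → 𝕋 T → ∀ s → T s → Sq b s
    T2 : ∀ T → 𝕋 T → ∀ s → T s → ∃[ t ] (s ⊑ t × Splitting T t)
    T3 : ∀ T' T → 𝕋 T' → 𝕋 T → T' ≤ₜ T → T' ⊆ᵀ T
    T4 : ∀ T → 𝕋 T → ∀ s → T s → 𝕋 (T ^ᵀ s) × (T ^ᵀ s) ≤ₜ T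
    T5 : ∀ T → 𝕋 T → ∀ n → (S : Seq → Tree) →
         (∀ t → Lv n T t → 𝕋 (S t) × S t ≤ₜ (T ^ᵀ t)) →
         let U : Tree
             U u = ∃[ t ] (Lv n T t × S t u)
         in 𝕋 U × U ≤ₜ T
            × (∀ t → Lv n T t → S t ≤ₜ U)
            × (∀ t t' → Lv n T t → Lv n T t' → t ≢ t' →
                 ¬ (∃[ R ] (𝕋 R × R ≤ₜ S t × R ≤ₜ S t')))
            × (∀ R → 𝕋 R → R ≤ₜ U →
                 ∃[ t ] (Lv n T t × ∃[ Q ] (𝕋 Q × Q ≤ₜ R × Q ≤ₜ S t)))
    T6 : (Ts : ℕ → Tree) → (∀ n → 𝕋 (Ts n)) → (∀ n → Ts (suc n) ≤ₜ Ts n) →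
         (∀ n → Ts (suc n) ⊆[ n ] Ts n) →
         let I : Tree
             I s = ∀ n → Ts n s
         in 𝕋 I × (∀ n → I ≤ₜ Ts n)

Increasing : Real → Set
Increasing f = ∀ m n → m < n → f m < f n

Dominating : (Real → Set) → Set
Dominating D = ∀ (g : Real) → ∃[ f ] (D f × ∃[ N ] (∀ n → n ≥ N → g n ≤ f n))

_* : Real → Real
(f *) zero = 0
(f *) (suc n) = f (suc ((f *) n))

ht : (ℕ → Seq) → Real
ht σ i = length (σ i)

InfOften : (ℕ → ℕ) → (ℕ → Seq) → Real → Set
InfOften b σ x = InProd b x × (∀ N → ∃[ n ] (n ≥ N × σ n ⊏ x))

module Submission where

-- Proof idea (a fusion argument).  Fix T ∈ 𝕋.  Using excluded middle choose,
-- for every node t of T, a splitting node split(t) ⊒ t of T.  Since b is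
-- finite-valued, |split(t)| is bounded on every level of sq_{<ω}(b), so there
-- is a strictly increasing G with |split(t)| < G(m) whenever |t| ≤ m.
-- Put M(0) = 0 and M(n+1) = G(G(M(n))).  Given nodes s_n with |s_n| ≥ M(n+1)
-- we build T ≥ R₁ ≥ R₂ ≥ …, where R_{n+1} arises from R_n by two prunings
-- via (T5): every node of level M(n) is sent to the splitting node above it
-- (creating one more splitting node below level G(M(n))), then every node of
-- level G(M(n)) is sent to a successor of its splitting node which is not an
-- initial segment of s_n.  Counting splitting nodes gives R_{n+2} ⊆_n R_{n+1},
-- so (T6) yields a fusion S ≤ T avoiding every s_n.  Finally, if f ∈ D
-- dominates G∘G from K on, then |σ^f(k)| = f*(k) ≥ M(k − K), so s_n :=
-- σ^f(n+K+1) is admissible, and no branch of S extends infinitely many σ^f(k).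

open import Defs
open import Level using (0ℓ)
open import Data.Nat using (ℕ; _<_)
open import Data.List using (List)
open import Data.Product using (Σ; ∃; ∃-syntax; _×_; _,_)
open import Relation.Nullary using (¬_)
open import Data.Empty using (⊥)
open import Relation.Binary.PropositionalEquality using (_≡_)
open import Axiom.ExcludedMiddle using (ExcludedMiddle)

open import Data.Nat using (zero; suc; _+_; _∸_; _≤_; _≥_; _⊔_; _⊓_; z≤n; s≤s; s≤s⁻¹; _<?_)
open import Data.Nat.Properties
open import Data.Fin using (Fin) renaming (zero to fzero; suc to fsuc)
import Data.Fin.Properties as Fin
open import Data.List using ([]; _∷_; _++_; [_]; length; take; drop; _∷ʳ_)
open import Data.List.Properties
  using (++-identityʳ; ++-assoc; length-++; length-++-≤ˡ; length-take; take-take; take++drop≡id;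
         ∷ʳ-injectiveʳ)
open import Data.Product using (proj₁; proj₂)
open import Data.Sum using (_⊎_; inj₁; inj₂)
open import Data.Empty using (⊥-elim)
open import Function using (_∘_)
open import Function.Definitions using (Injective)
open import Relation.Nullary using (Dec; yes; no)
open import Relation.Binary.PropositionalEquality using (refl; sym; trans; cong; subst; module ≡-Reasoning)

⊑-refl : ∀ a → a ⊑ a
⊑-refl a = [] , ++-identityʳ a

⊑-trans : ∀ {a b c} → a ⊑ b → b ⊑ c → a ⊑ c
⊑-trans {a} (u , refl) (v , refl) = u ++ v , sym (++-assoc a u v)

⊑-length : ∀ {a b} → a ⊑ b → length a ≤ length b
⊑-length {a} (_ , refl) = length-++-≤ˡ a

⊑-∷ʳ : ∀ (a : Seq) (i : ℕ) → a ⊑ (a ∷ʳ i)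
⊑-∷ʳ a i = [ i ] , refl

length-∷ʳ : ∀ (a : Seq) (i : ℕ) → length (a ∷ʳ i) ≡ suc (length a)
length-∷ʳ a i = trans (length-++ a) (+-comm (length a) 1)

take-⊑ : ∀ L (y : Seq) → take L y ⊑ y
take-⊑ L y = drop L y , take++drop≡id L y

length-take-≤ : ∀ {L} (y : Seq) → L ≤ length y → length (take L y) ≡ L
length-take-≤ {L} y L≤y = trans (length-take L y) (m≤n⇒m⊓n≡m L≤y)

⊑⇒take : ∀ {a s} → a ⊑ s → take (length a) s ≡ a
⊑⇒take {[]} _ = refl
⊑⇒take {x ∷ a} (u , refl) = cong (x ∷_) (⊑⇒take (u , refl))

⊑-unique : ∀ {a b s} → a ⊑ s → b ⊑ s → length a ≡ length b → a ≡ b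
⊑-unique {s = s} a⊑s b⊑s eq =
  trans (sym (⊑⇒take a⊑s)) (trans (cong (λ k → take k s) eq) (⊑⇒take b⊑s))

comparable⇒⊑ : ∀ {a b} → a ⊑ b ⊎ b ⊑ a → length a ≤ length b → a ⊑ b
comparable⇒⊑ (inj₁ a⊑b) _ = a⊑b
comparable⇒⊑ {a} (inj₂ b⊑a) a≤b =
  subst (a ⊑_) (⊑-unique (⊑-refl a) b⊑a (≤-antisym a≤b (⊑-length b⊑a))) (⊑-refl a)

⊑-take : ∀ {x y} L → x ⊑ y → length x ≤ L → x ⊑ take L y
⊑-take {[]} L _ _ = take L _ , refl
⊑-take {x ∷ xs} (suc L) (u , refl) (s≤s xs≤L) with ⊑-take L (u , refl) xs≤L
... | v , eq = v , cong (x ∷_) eq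

take-prefix : ∀ {v v'} k → v ⊑ v' → k ≤ length v → take k v ≡ take k v'
take-prefix {v} {v'} k v⊑v' k≤v = begin
  take k v                     ≡⟨ cong (take k) (sym (⊑⇒take v⊑v')) ⟩
  take k (take (length v) v')  ≡⟨ take-take k (length v) v' ⟩
  take (k ⊓ length v) v'       ≡⟨ cong (λ j → take j v') (m≤n⇒m⊓n≡m k≤v) ⟩
  take k v'                    ∎
  where open ≡-Reasoning

boundBelow : ∀ n (g : ℕ → ℕ) → ∃[ B ] (∀ {k} → k < n → g k ≤ B)
boundBelow zero g = 0 , λ ()
boundBelow (suc n) g with boundBelow n g
... | B , bound = B ⊔ g n , below
  where
  below : ∀ {k} → k < suc n → g k ≤ B ⊔ g n
  below k<1+n with m≤n⇒m<n∨m≡n (s≤s⁻¹ k<1+n)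
  ... | inj₁ k<n = ≤-trans (bound k<n) (m≤m⊔n B (g n))
  ... | inj₂ refl = m≤n⊔m B (g n)

-- Since b is finite-valued, each level of ∏_{j} b(i+j) is finite, so every
-- h : Seq → ℕ is bounded on it.  This is what makes the levels M(n) exist.
levelBound : (b : ℕ → ℕ) → ∀ i m (h : Seq → ℕ) →
             ∃[ B ] (∀ {s} → InSq b i s → length s ≡ m → h s ≤ B)
levelBound b i zero h = h [] , λ { nil refl → ≤-refl }
levelBound b i (suc m) h = proj₁ overall , bound
  where
  branch : ∀ k → ∃[ B ] (∀ {s} → InSq b (suc i) s → length s ≡ m → h (k ∷ s) ≤ B)
  branch k = levelBound b (suc i) m (λ s → h (k ∷ s))
  overall : ∃[ B ] (∀ {k} → k < b i → proj₁ (branch k) ≤ B)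
  overall = boundBelow (b i) (λ k → proj₁ (branch k))
  bound : ∀ {s} → InSq b i s → length s ≡ suc m → h s ≤ proj₁ overall
  bound (cons k<b s∈) len = ≤-trans (proj₂ (branch _) s∈ (suc-injective len)) (proj₂ overall k<b)

module Majorant (A : ℕ → ℕ) where
  G : ℕ → ℕ
  G zero = suc (A 0)
  G (suc m) = suc (G m + A (suc m))

  A<G : ∀ m → A m < G m
  A<G zero = ≤-refl
  A<G (suc m) = s≤s (m≤n+m (A (suc m)) (G m))

  G-step : ∀ m → G m < G (suc m)
  G-step m = s≤s (m≤m+n (G m) (A (suc m)))

  G-mono : ∀ {m m'} → m ≤ m' → G m ≤ G m'
  G-mono {m' = zero} z≤n = ≤-refl
  G-mono {m} {suc m'} m≤ with m≤n⇒m<n∨m≡n m≤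
  ... | inj₁ m<1+m' = ≤-trans (G-mono (s≤s⁻¹ m<1+m')) (<⇒≤ (G-step m'))
  ... | inj₂ refl = ≤-refl

  id<G : ∀ m → m < G m
  id<G zero = s≤s z≤n
  id<G (suc m) = ≤-trans (s≤s (id<G m)) (G-step m)

increasing⇒inflationary : ∀ f → Increasing f → ∀ x → x ≤ f x
increasing⇒inflationary f f-inc zero = z≤n
increasing⇒inflationary f f-inc (suc x) =
  ≤-trans (s≤s (increasing⇒inflationary f f-inc x)) (f-inc x (suc x) (n<1+n x))

*-inflationary : ∀ f → Increasing f → ∀ j → j ≤ (f *) j
*-inflationary f f-inc zero = z≤n
*-inflationary f f-inc (suc j) =
  ≤-trans (s≤s (*-inflationary f f-inc j)) (increasing⇒inflationary f f-inc _)

-- Counting splitting nodes.  X has at least n splitting nodes strictly below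
-- v: their lengths, listed injectively.
AtLeastSplits : ℕ → Tree → Seq → Set
AtLeastSplits n X v = Σ (Fin n → ℕ) λ h → Injective _≡_ _≡_ h ×
  (∀ i → h i < length v × Splitting X (take (h i) v))

splitting-kept : ∀ {X Y : Tree} {u} →
  (∀ {q} → u ⊑ q → length q ≤ suc (length u) → X q → Y q) → Splitting X u → Splitting Y u
splitting-kept {u = u} keep (uX , i , j , i≢j , iX , jX) =
  keep (⊑-refl u) (n≤1+n _) uX , i , j , i≢j ,
  keep (⊑-∷ʳ u i) (≤-reflexive (length-∷ʳ u i)) iX ,
  keep (⊑-∷ʳ u j) (≤-reflexive (length-∷ʳ u j)) jX

splits-transfer : ∀ {n X Y v v'} → v ⊑ v' →
  (∀ {p} → length p < length v → Splitting X p → Splitting Y p) →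
  AtLeastSplits n X v → AtLeastSplits n Y v'
splits-transfer {Y = Y} {v} {v'} v⊑v' transfer (h , h-inj , h-spl) = h , h-inj , moved
  where
  moved : ∀ i → h i < length v' × Splitting Y (take (h i) v')
  moved i = <-≤-trans h<v (⊑-length v⊑v') ,
            subst (Splitting Y) (take-prefix (h i) v⊑v' (<⇒≤ h<v))
              (transfer (subst (_< length v) (sym (length-take-≤ v (<⇒≤ h<v))) h<v) (proj₂ (h-spl i)))
    where
    h<v = proj₁ (h-spl i)

splits-add : ∀ {n Y v v' k} → v ⊑ v' → AtLeastSplits n Y v →
  length v ≤ k → k < length v' → Splitting Y (take k v') → AtLeastSplits (suc n) Y v'
splits-add {n} {Y} {v} {v'} {k} v⊑v' known@(h , h-inj , h-spl) v≤k k<v' new = h' , h'-inj , h'-spl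
  where
  moved : AtLeastSplits n Y v'
  moved = splits-transfer {X = Y} v⊑v' (λ _ sp → sp) known
  h<k : ∀ i → h i < k
  h<k i = <-≤-trans (proj₁ (h-spl i)) v≤k
  h' : Fin (suc n) → ℕ
  h' fzero = k
  h' (fsuc i) = h i
  h'-inj : Injective _≡_ _≡_ h'
  h'-inj {fzero} {fzero} _ = refl
  h'-inj {fzero} {fsuc j} eq = ⊥-elim (<-irrefl (sym eq) (h<k j))
  h'-inj {fsuc i} {fzero} eq = ⊥-elim (<-irrefl eq (h<k i))
  h'-inj {fsuc i} {fsuc j} eq = cong fsuc (h-inj eq)
  h'-spl : ∀ i → h' i < length v' × Splitting Y (take (h' i) v')
  h'-spl fzero = k<v' , new
  h'-spl (fsuc i) = proj₂ (proj₂ moved) i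

-- by the pigeonhole principle, a node with n+1 splitting nodes below it is
-- not in spl_n
more-splits⇒¬Spl : ∀ {n X s} → AtLeastSplits (suc n) X s → ¬ Spl n X s
more-splits⇒¬Spl {n} (h , h-inj , h-spl) (_ , e , _ , _ , enumerates) =
  let (i , j , i<j , same-index) = Fin.pigeonhole (n<1+n n) (λ i → proj₁ (index i))
  in Fin.<-irrefl (h-inj (trans (sym (proj₂ (index i))) (trans (cong e same-index) (proj₂ (index j)))))
                  i<j
  where
  index : ∀ i → ∃[ j ] (e j ≡ h i)
  index i = enumerates (h i) (proj₁ (h-spl i)) (proj₂ (h-spl i))

choice : ExcludedMiddle 0ℓ → {A B : Set} {P : A → Set} (Q : A → B → Set) → B →
         (∀ a → P a → ∃ (Q a)) → ∃[ c ] (∀ a → P a → Q a (c a))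
choice em {A} {B} {P} Q default witness = (λ a → pick a em) , λ a pa → pick-ok a em pa
  where
  pick : ∀ a → Dec (P a) → B
  pick a (yes pa) = proj₁ (witness a pa)
  pick a (no _) = default
  pick-ok : ∀ a (d : Dec (P a)) → P a → Q a (pick a d)
  pick-ok a (yes pa) _ = proj₂ (witness a pa)
  pick-ok a (no ¬pa) pa = ⊥-elim (¬pa pa)

avoidingChild : ExcludedMiddle 0ℓ → ∀ {X u} → Splitting X u → ∀ s →
                ∃[ k ] (X (u ∷ʳ k) × ¬ ((u ∷ʳ k) ⊑ s))
avoidingChild em {u = u} (_ , i , j , i≢j , iX , jX) s with em {(u ∷ʳ i) ⊑ s}
... | no i⋢s = i , iX , i⋢s
... | yes i⊑s = j , jX , λ j⊑s →
  i≢j (∷ʳ-injectiveʳ u u (⊑-unique i⊑s j⊑s (trans (length-∷ʳ u i) (sym (length-∷ʳ u j)))))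

module TreeFacts {b : ℕ → ℕ} (F : BTreeForcing b) where
  open BTreeForcing F using (𝕋; T1-tree; T2)

  closed : ∀ X → 𝕋 X → ∀ {s t} → s ⊑ t → X t → X s
  closed X X∈𝕋 {s} {t} = proj₂ (T1-tree X X∈𝕋) s t

  longer : ∀ X → 𝕋 X → ∀ k {x} → X x → ∃[ y ] (X y × x ⊑ y × k ≤ length y)
  longer X X∈𝕋 zero {x} xX = x , xX , ⊑-refl x , z≤n
  longer X X∈𝕋 (suc k) xX with longer X X∈𝕋 k xX
  ... | y , yX , x⊑y , k≤y with T2 X X∈𝕋 y yX
  ... | z , y⊑z , _ , i , _ , _ , ziX , _ =
    z ∷ʳ i , ziX , ⊑-trans x⊑y (⊑-trans y⊑z (⊑-∷ʳ z i)) ,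
    subst (suc k ≤_) (sym (length-∷ʳ z i)) (s≤s (≤-trans k≤y (⊑-length y⊑z)))

  extendTo : ∀ X → 𝕋 X → ∀ {x} → X x → ∀ {L} → length x ≤ L →
             ∃[ y ] (X y × x ⊑ y × length y ≡ L)
  extendTo X X∈𝕋 xX {L} x≤L with longer X X∈𝕋 L xX
  ... | y , yX , x⊑y , L≤y =
    take L y , closed X X∈𝕋 (take-⊑ L y) yX , ⊑-take L x⊑y x≤L , length-take-≤ y L≤y

module Construction (em : ExcludedMiddle 0ℓ) (b : ℕ → ℕ) (F : BTreeForcing b)
                    (T : Tree) (T∈𝕋 : BTreeForcing.𝕋 F T) where
  open BTreeForcing F using (𝕋; _≤ₜ_; T1-sq; T2; T3; T4; T5; T6)
    renaming (≤-refl to ≤ₜ-refl; ≤-trans to ≤ₜ-trans)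
  open TreeFacts F

  splitAbove : ∃[ split ] (∀ t → T t → t ⊑ split t × Splitting T (split t))
  splitAbove = choice em (λ t u → t ⊑ u × Splitting T u) [] (T2 T T∈𝕋)

  split : Seq → Seq
  split = proj₁ splitAbove

  split-⊒ : ∀ {t} → T t → t ⊑ split t
  split-⊒ {t} tT = proj₁ (proj₂ splitAbove t tT)

  split-splits : ∀ {t} → T t → Splitting T (split t)
  split-splits {t} tT = proj₂ (proj₂ splitAbove t tT)

  -- G majorizes the length of split on each level
  open Majorant (λ m → proj₁ (levelBound b 0 m (λ t → length (split t)))) public

  split-short : ∀ {t m} → T t → length t ≤ m → length (split t) < G m
  split-short {t} tT t≤m = <-≤-trans (≤-<-trans bounded (A<G (length t))) (G-mono t≤m)
    where
    bounded = proj₂ (levelBound b 0 (length t) (λ t → length (split t))) (T1-sq T T∈𝕋 t tT) refl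

  avoidAbove : (s : Seq) →
               ∃[ k ] (∀ w → T w → T (split w ∷ʳ k w) × ¬ ((split w ∷ʳ k w) ⊑ s))
  avoidAbove s = choice em (λ w k → T (split w ∷ʳ k) × ¬ ((split w ∷ʳ k) ⊑ s)) 0
                   (λ w wT → avoidingChild em {X = T} (split-splits wT) s)

  ConeAbove : ℕ → Tree → Set
  ConeAbove m X = ∀ {v y} → X v → m ≤ length v → v ⊑ y → T y → X y

  module Prune (R : Tree) (R∈𝕋 : 𝕋 R) (m : ℕ) (R-cone : ConeAbove m R)
               (c : Seq → Seq) (c-⊒ : ∀ {t} → Lv m R t → t ⊑ c t)
               (c-T : ∀ {t} → Lv m R t → T (c t)) where
    Piece : Seq → Tree
    Piece t = (R ^ᵀ t) ^ᵀ c t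

    U : Tree
    U y = ∃[ t ] (Lv m R t × Piece t y)

    c-R : ∀ {t} → Lv m R t → R (c t)
    c-R lv@(tR , len) = R-cone tR (≤-reflexive (sym len)) (c-⊒ lv) (c-T lv)

    piece-ok : ∀ t → Lv m R t → 𝕋 (Piece t) × Piece t ≤ₜ (R ^ᵀ t)
    piece-ok t lv@(tR , _) = T4 (R ^ᵀ t) (proj₁ (T4 R R∈𝕋 t tR)) (c t) (c-R lv , inj₁ (c-⊒ lv))

    U∈𝕋 : 𝕋 U
    U∈𝕋 = proj₁ (T5 R R∈𝕋 m Piece piece-ok)

    U≤R : U ≤ₜ R
    U≤R = proj₁ (proj₂ (T5 R R∈𝕋 m Piece piece-ok))

    U⊆R : U ⊆ᵀ R
    U⊆R y (_ , _ , (yR , _) , _) = yR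

    U-above : ∀ {t y} → Lv m R t → c t ⊑ y → T y → U y
    U-above {t} lv@(tR , len) ct⊑y yT =
      t , lv , (R-cone tR (≤-reflexive (sym len)) t⊑y yT , inj₁ t⊑y) , inj₁ ct⊑y
      where
      t⊑y = ⊑-trans (c-⊒ lv) ct⊑y

    U-below : ∀ {p} → R p → length p ≤ m → U p
    U-below pR p≤m with extendTo R R∈𝕋 pR p≤m
    ... | t , tR , p⊑t , len =
      t , (tR , len) , (pR , inj₂ p⊑t) , inj₂ (⊑-trans p⊑t (c-⊒ (tR , len)))

    U-passes : ∀ m' → (∀ {t} → Lv m R t → length (c t) ≤ m') →
               ∀ {v} → U v → m' ≤ length v → ∃[ t ] (Lv m R t × c t ⊑ v)
    U-passes m' c-short (t , lv , _ , comparable) m'≤v =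
      t , lv , comparable⇒⊑ comparable (≤-trans (c-short lv) m'≤v)

    U-cone : ∀ m' → (∀ {t} → Lv m R t → length (c t) ≤ m') → ConeAbove m' U
    U-cone m' c-short vU m'≤v v⊑y yT with U-passes m' c-short vU m'≤v
    ... | t , lv , ct⊑v = U-above lv (⊑-trans ct⊑v v⊑y) yT

  M : ℕ → ℕ
  M zero = 0
  M (suc n) = G (G (M n))

  record Stage (n : ℕ) : Set₁ where
    field
      R : Tree
      R∈𝕋 : 𝕋 R
      R≤T : R ≤ₜ T
      cone : ConeAbove (M n) R
      splits : ∀ {v} → R v → length v ≡ M n → AtLeastSplits n R v

    R⊆T : R ⊆ᵀ T
    R⊆T = T3 R T R∈𝕋 T∈𝕋 R≤T

  initial : Stage 0
  initial = record
    { R = T ; R∈𝕋 = T∈𝕋 ; R≤T = ≤ₜ-refl T T∈𝕋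
    ; cone = λ _ _ _ yT → yT ; splits = λ _ _ → (λ ()) , (λ { {()} }) , (λ ()) }

  record Refinement {n : ℕ} (st : Stage n) (s : Seq) : Set₁ where
    field
      next : Stage (suc n)
      next≤ : Stage.R next ≤ₜ Stage.R st
      excludes : ¬ Stage.R next s
      keeps : ∀ {y} → length y ≡ M n → Stage.R st y → Stage.R next y

  -- the fusion step: first prune at level M n to the splitting nodes above,
  -- then at level L = G (M n) to successors of splitting nodes avoiding s
  refine : ∀ {n} (st : Stage n) (s : Seq) → M (suc n) ≤ length s → Refinement st s
  refine {n} st s s-long = record { next = next ; next≤ = U≤R ; excludes = excludes ; keeps = keeps }
    where
    open Stage st
    L : ℕ
    L = G (M n)

    split-below-L : ∀ {t} → Lv (M n) R t → length (split t) < L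
    split-below-L (tR , len) = split-short (R⊆T _ tR) (≤-reflexive len)

    module First = Prune R R∈𝕋 (M n) cone split
                     (λ (tR , _) → split-⊒ (R⊆T _ tR))
                     (λ (tR , _) → proj₁ (split-splits (R⊆T _ tR)))

    R₁⊆T : First.U ⊆ᵀ T
    R₁⊆T y yR₁ = R⊆T y (First.U⊆R y yR₁)

    avoid = avoidAbove s

    kid : Seq → Seq
    kid w = split w ∷ʳ proj₁ avoid w

    module Second = Prune First.U First.U∈𝕋 L (First.U-cone L (<⇒≤ ∘ split-below-L)) kid
                      (λ (wR₁ , _) → ⊑-trans (split-⊒ (R₁⊆T _ wR₁)) (⊑-∷ʳ _ _))
                      (λ (wR₁ , _) → proj₁ (proj₂ avoid _ (R₁⊆T _ wR₁)))
    open Second using (U)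

    kid-short : ∀ {w} → Lv L First.U w → length (kid w) ≤ M (suc n)
    kid-short {w} (wR₁ , len) = subst (_≤ G L) (sym (length-∷ʳ (split w) (proj₁ avoid w)))
                                      (split-short (R₁⊆T w wR₁) (≤-reflexive len))

    U≤R : U ≤ₜ R
    U≤R = ≤ₜ-trans U First.U R Second.U∈𝕋 First.U∈𝕋 R∈𝕋 Second.U≤R First.U≤R

    -- s, being long, would have to pass through some kid w
    excludes : ¬ U s
    excludes sU with Second.U-passes (M (suc n)) kid-short sU s-long
    ... | w , (wR₁ , _) , kid⊑s = proj₂ (proj₂ avoid w (R₁⊆T w wR₁)) kid⊑s

    below : ∀ {p} → R p → length p ≤ M n → U p
    below pR p≤ = Second.U-below (First.U-below pR p≤) (≤-trans p≤ (<⇒≤ (id<G (M n))))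

    keeps : ∀ {y} → length y ≡ M n → R y → U y
    keeps len yR = below yR (≤-reflexive len)

    old-split : ∀ {p} → length p < M n → Splitting R p → Splitting U p
    old-split {p} p<Mn = splitting-kept {u = p} (λ {q} _ q≤ qR → below {q} qR (≤-trans q≤ p<Mn))

    new-split : ∀ {t} → Lv (M n) R t → Splitting U (split t)
    new-split {t} lv@(tR , _) = splitting-kept lift (split-splits (R⊆T t tR))
      where
      lift : ∀ {q} → split t ⊑ q → length q ≤ suc (length (split t)) → T q → U q
      lift st⊑q q≤ qT = Second.U-below (First.U-above lv st⊑q qT) (≤-trans q≤ (split-below-L lv))

    L≤ : ∀ {v : Seq} → length v ≡ M (suc n) → L ≤ length v
    L≤ {v} len = subst (L ≤_) (sym len) (<⇒≤ (id<G L))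

    -- the n old splitting nodes below level M n plus the new one
    splits′ : ∀ {v} → U v → length v ≡ M (suc n) → AtLeastSplits (suc n) U v
    splits′ {v} vU len with First.U-passes L (<⇒≤ ∘ split-below-L) (Second.U⊆R v vU) (L≤ {v} len)
    ... | t , lv@(tR , t-len) , st⊑v =
      splits-add {Y = U} {v = t} (⊑-trans t⊑st st⊑v) old (⊑-length t⊑st)
        (<-≤-trans (split-below-L lv) (L≤ {v} len)) (subst (Splitting U) (sym (⊑⇒take st⊑v)) (new-split lv))
      where
      t⊑st = split-⊒ (R⊆T t tR)
      old : AtLeastSplits n U t
      old = splits-transfer {X = R} (⊑-refl t) (λ {p} p<t → old-split (subst (length p <_) t-len p<t))
              (splits tR t-len)

    next : Stage (suc n)
    next = record
      { R = U ; R∈𝕋 = Second.U∈𝕋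
      ; R≤T = ≤ₜ-trans U R T Second.U∈𝕋 R∈𝕋 T∈𝕋 U≤R R≤T
      ; cone = Second.U-cone (M (suc n)) kid-short ; splits = splits′ }

  -- Fusion: for nodes kill n of length ≥ M (n+1) there is S ≤ T containing
  -- none of them, the (T6)-limit of the stages refining away kill 0, kill 1, …
  fusion : (kill : ℕ → Seq) → (∀ n → M (suc n) ≤ length (kill n)) →
           ∃[ S ] (𝕋 S × S ≤ₜ T × ∀ n → ¬ S (kill n))
  fusion kill kill-long = S , S∈𝕋 , S≤T , S-excludes
    where
    stage : ∀ n → Stage n
    step : ∀ n → Refinement (stage n) (kill n)
    stage zero = initial
    stage (suc n) = Refinement.next (step n)
    step n = refine (stage n) (kill n) (kill-long n)

    Ts : ℕ → Tree
    Ts n = Stage.R (stage (suc n))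

    Ts∈𝕋 : ∀ n → 𝕋 (Ts n)
    Ts∈𝕋 n = Stage.R∈𝕋 (stage (suc n))

    Ts-⊆ : ∀ n → Ts (suc n) ⊆ᵀ Ts n
    Ts-⊆ n = T3 (Ts (suc n)) (Ts n) (Ts∈𝕋 (suc n)) (Ts∈𝕋 n) (Refinement.next≤ (step (suc n)))

    -- spl_n(Ts n) lies below level M (n+1), where n+1 splitting nodes are reached
    spl-short : ∀ n s → Spl n (Ts n) s → length s < M (suc n)
    spl-short n s spl with length s <? M (suc n)
    ... | yes s-short = s-short
    ... | no s-long = ⊥-elim (more-splits⇒¬Spl {X = Ts n} {s = s} below-s spl)
      where
      top = take (M (suc n)) s
      below-top : AtLeastSplits (suc n) (Ts n) top
      below-top = Stage.splits (stage (suc n)) (closed (Ts n) (Ts∈𝕋 n) (take-⊑ _ s) (proj₁ (proj₁ spl)))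
                    (length-take-≤ s (≮⇒≥ s-long))
      below-s : AtLeastSplits (suc n) (Ts n) s
      below-s = splits-transfer {X = Ts n} (take-⊑ _ s) (λ _ sp → sp) below-top

    fused = T6 Ts Ts∈𝕋 (λ n → Refinement.next≤ (step (suc n)))
               (λ n → Ts-⊆ n , M (suc n) , spl-short n ,
                      λ y len → Ts-⊆ n y , Refinement.keeps (step (suc n)) len)

    S : Tree
    S s = ∀ n → Ts n s

    S∈𝕋 : 𝕋 S
    S∈𝕋 = proj₁ fused

    S≤T : S ≤ₜ T
    S≤T = ≤ₜ-trans S (Ts 0) T S∈𝕋 (Ts∈𝕋 0) T∈𝕋 (proj₂ fused 0)
                   (Refinement.next≤ (step 0))

    S-excludes : ∀ n → ¬ S (kill n)
    S-excludes n killS = Refinement.excludes (step n) (killS n)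

  M≤f* : ∀ f → Increasing f → ∀ K → (∀ n → n ≥ K → G (G n) ≤ f n) →
         ∀ n → M n ≤ (f *) (n + K)
  M≤f* f f-inc K dominates zero = z≤n
  M≤f* f f-inc K dominates (suc n) =
    ≤-trans (G-mono (G-mono (≤-trans (M≤f* f f-inc K dominates n) (n≤1+n _))))
            (dominates _ (≤-trans (m≤n+m K n) (≤-trans (*-inflationary f f-inc (n + K)) (n≤1+n _))))

  -- for such f and |σ k| = f* k, some S ≤ T has no branch in [σ]_∞:
  -- S excludes σ k for all k > K
  avoidingCondition : ∀ f → Increasing f → ∀ K → (∀ n → n ≥ K → G (G n) ≤ f n) →
    (σ : ℕ → Seq) → (∀ i → length (σ i) ≡ (f *) i) →
    ∃[ S ] (𝕋 S × S ≤ₜ T × (∀ x → InfOften b σ x → Body S x → ⊥))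
  avoidingCondition f f-inc K dominates σ σ-len =
    let (S , S∈𝕋 , S≤T , S-excludes) = fusion (λ n → σ (n + suc K)) σ-long
    in S , S∈𝕋 , S≤T , λ x (_ , often) x∈S →
         let (k , k>K , σk⊏x) = often (suc K)
         in S-excludes (k ∸ suc K)
              (subst S (trans σk⊏x (cong σ (sym (m∸n+n≡m k>K)))) (x∈S (length (σ k))))
    where
    σ-long : ∀ n → M (suc n) ≤ length (σ (n + suc K))
    σ-long n = subst (M (suc n) ≤_) (sym (trans (σ-len (n + suc K)) (cong (f *) (+-suc n K))))
                 (M≤f* f f-inc K dominates (suc n))

lemma4p4 : ExcludedMiddle 0ℓ →
    (b : ℕ → ℕ) → (∀ i → 0 < b i) →
    (F : BTreeForcing b) →
    (D : Real → Set) → (∀ f → D f → Increasing f) → Dominating D →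
    (σ : Real → ℕ → Seq) →
    (∀ f → D f → (∀ i → Sq b (σ f i)) × (∀ i → ht (σ f) i ≡ (f *) i)) →
    ∀ T → BTreeForcing.𝕋 F T →
    ∃[ S ] (BTreeForcing.𝕋 F S × BTreeForcing._≤ₜ_ F S T ×
      ∃[ f ] (D f × (∀ x → InfOften b (σ f) x → Body S x → ⊥)))
lemma4p4 em b _ F D D-increasing D-dominating σ σ-spec T T∈𝕋 =
  let open Construction em b F T T∈𝕋
      (f , f∈D , K , dominates) = D-dominating (λ n → G (G n))
      (S , S∈𝕋 , S≤T , disjoint) =
        avoidingCondition f (D-increasing f f∈D) K dominates (σ f) (proj₂ (σ-spec f f∈D))
  in S , S∈𝕋 , S≤T , f , f∈D , disjoint
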